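{- Let $\pi$ and $\iota$ be permutations of type $(k,n)$ with $\iota\le_\circ\pi$, and set $\mu=\iota^{ -1}\pi\iota$. Let $f,i,m\in\mathrm{Bound}(k,n)$ be the lifts of $\pi,\iota,\mu$ respectively. Then $m=i^{ -1}fi$.
   Context: $\pi\in S_n$ has type $(k,n)$ if $\#\{a:a\le\pi^{ -1}(a)\}=k$. $\mathrm{Bound}(k,n)$ = bijections $f:\mathbb Z\to\mathbb Z$ with $f(a+n)=f(a)+n$, $a<f(a)\le a+n$ for all $a$, and $\frac1n\sum_{a=1}^n(f(a)-a)=k$; reduction mod $n$ is a bijection from $\mathrm{Bound}(k,n)$ to permutations of type $(k,n)$, and $f$ is the lift of its reduction. $\ell(f)=\#\{(i,j):i\in[n],j\in\mathbb Z,i<j,f(i)>f(j)\}$; $u\le_Rf$ iff $\ell(f)=\ell(u)+\ell(u^{ -1}f)$; $\iota\le_\circ\pi$ iff the lifts satisfy $i\le_Rf$. -}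

module Defs where

open import Data.Nat as ℕ using (ℕ; suc; _≤?_)
open import Data.Integer as ℤ using (ℤ; +_; _+_; _-_; _*_; _<_; _≤_)
open import Data.Fin using (Fin; toℕ)
open import Data.Fin.Permutation using (Permutation′; _⟨$⟩ʳ_; _⟨$⟩ˡ_)
open import Data.List using (List; length; filter; map; foldr; upTo; allFin)
open import Data.List.Membership.Propositional using (_∈_)
open import Data.List.Relation.Unary.Unique.Propositional using (Unique)
open import Data.Product using (Σ; ∃; _×_; _,_)
open import Function using (_∘_)
open import Function.Bundles using (_↔_; Inverse; _⇔_)
open import Function.Construct.Composition using (_↔-∘_)
open import Function.Construct.Symmetry using (↔-sym)
open import Relation.Binary.PropositionalEquality using (_≡_)

-- Elements of Fin n represent [n] = {1,…,n} via j ↦ toℕ j + 1 (order preserving).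

HasType : ℕ → (n : ℕ) → Permutation′ n → Set
HasType k n π =
  length (filter (λ a → toℕ a ≤? toℕ (π ⟨$⟩ˡ a)) (allFin n)) ≡ k

-- composition of permutations of [n]: (σ ∘ₚ τ)(a) = σ(τ(a))
_∘ₚ_ : ∀ {n} → Permutation′ n → Permutation′ n → Permutation′ n
σ ∘ₚ τ = σ ↔-∘ τ

_⁻¹ₚ : ∀ {n} → Permutation′ n → Permutation′ n
σ ⁻¹ₚ = ↔-sym σ

Bij : Set
Bij = ℤ ↔ ℤ

app : Bij → ℤ → ℤ
app = Inverse.to

_∘ᵇ_ : Bij → Bij → Bij
g ∘ᵇ h = g ↔-∘ h

_⁻¹ᵇ : Bij → Bij
g ⁻¹ᵇ = ↔-sym g

sumℤ : List ℤ → ℤ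
sumℤ = foldr _+_ (+ 0)

Bound : ℕ → ℕ → Bij → Set
Bound k n f =
  (∀ a → app f (a + + n) ≡ app f a + + n)
  × (∀ a → (a < app f a) × (app f a ≤ a + + n))
  × (sumℤ (map (λ j → app f (+ suc j) - + suc j) (upTo n)) ≡ + (k ℕ.* n))

ReducesTo : (n : ℕ) → Bij → Permutation′ n → Set
ReducesTo n f π =
  ∀ (j : Fin n) → ∃ λ (q : ℤ) →
    app f (+ suc (toℕ j)) ≡ + suc (toℕ (π ⟨$⟩ʳ j)) + q * + n

IsLift : ℕ → (n : ℕ) → Permutation′ n → Bij → Set
IsLift k n π f = Bound k n f × ReducesTo n f π

Inversion : ℕ → Bij → ℤ × ℤ → Set
Inversion n g (i , j) =
  (+ 1 ≤ i) × (i ≤ + n) × (i < j) × (app g j < app g i)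

HasLength : ℕ → Bij → ℕ → Set
HasLength n g N =
  Σ (List (ℤ × ℤ)) λ L →
    Unique L × (∀ p → (p ∈ L) ⇔ Inversion n g p) × (length L ≡ N)

_≤R[_]_ : Bij → ℕ → Bij → Set
u ≤R[ n ] f =
  ∃ λ a → ∃ λ b → ∃ λ c →
    HasLength n f a × HasLength n u b × HasLength n ((u ⁻¹ᵇ) ∘ᵇ f) c
    × (a ≡ b ℕ.+ c)

-- Write v = i⁻¹ f, so that f = i v and m = v i. An inversion (p, q) of f is either an
-- inversion of v or, shifted by a multiple of n, (v p, v q) is an inversion of i; this
-- assignment is injective, so ℓ(f) = ℓ(i) + ℓ(v) leaves no room for an inversion of v
-- that is not an inversion of f. That is exactly what a < m(a) ≤ a + n needs: with
-- b = i(a), a violation would make (f⁻¹ b, b), resp. (b, f⁻¹(b + n)), such an inversion. Finally the displacement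
-- Σₐ (g(a) − a) over a window is additive under composition of periodic bijections, so
-- i m = f i shows that m has the same displacement k n as f.
{-# OPTIONS --safe #-}
module Submission where

open import Defs
open import Data.Nat as ℕ using (ℕ; zero; suc; z≤n; s≤s)
import Data.Nat.Properties as ℕP
open import Data.Integer as ℤ using (ℤ; +_; -[1+_]; _+_; _-_; _*_; -_; _<_; _≤_; +≤+)
import Data.Integer.Properties as ℤP
open import Data.Integer.DivMod using (_/ℕ_; _%ℕ_; a≡a%ℕn+[a/ℕn]*n; n%ℕd<d)
open import Data.Integer.Tactic.RingSolver using (solve-∀)
open import Algebra.Properties.AbelianGroup ℤP.+-0-abelianGroup using (∙-cancelˡ; ∙-cancelʳ)
open import Algebra.Properties.CommutativeMonoid.Sum ℤP.+-0-commutativeMonoid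
  using (sum-syntax; sum-cong-≗; sum-permute; ∑-distrib-+)
open import Data.Fin using (Fin; toℕ)
open import Data.Fin.Permutation as Perm using (Permutation′; _⟨$⟩ʳ_; _⟨$⟩ˡ_)
open import Data.List using (List; []; _∷_; length; map; _++_; upTo; applyUpTo)
open import Data.List.Properties using (length-removeAt′; length-map; length-++; map-upTo)
open import Data.List.Relation.Unary.Any using (here; there)
open import Data.List.Relation.Unary.All as All using (All; _∷_)
import Data.List.Relation.Unary.All.Properties as All
open import Data.List.Relation.Unary.AllPairs using ([]; _∷_)
open import Data.List.Relation.Unary.Unique.Propositional using (Unique)
open import Data.List.Relation.Binary.Subset.Propositional using (_⊆_)
open import Data.List.Membership.Propositional using (_∈_; _─_)
open import Data.List.Membership.Propositional.Properties using (∈-map⁺; ∈-map⁻; ∈-++⁺ˡ; ∈-++⁺ʳ)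
open import Data.Product using (∃; _×_; _,_; proj₁; proj₂)
open import Data.Sum using (_⊎_; inj₁; inj₂; [_,_]′)
open import Data.Sum.Properties using (inj₁-injective; inj₂-injective)
open import Data.Empty using (⊥-elim)
open import Function using (_∘_)
open import Function.Bundles using (Inverse; Equivalence; Injection)
open import Function.Properties.Inverse using (Inverse⇒Injection)
open import Relation.Nullary using (¬_; yes; no)
open import Relation.Binary.PropositionalEquality
open import Relation.Binary.Definitions using (tri<; tri≈; tri>)

module _ {a} {A : Set a} where

  ∈-─⁺ : ∀ {x y} {ys : List A} (x∈ys : x ∈ ys) → y ∈ ys → y ≢ x → y ∈ ys ─ x∈ys
  ∈-─⁺ (here refl) (here refl) y≢x = ⊥-elim (y≢x refl)
  ∈-─⁺ (here _)    (there y∈ys) _  = y∈ys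
  ∈-─⁺ (there _)   (here y≡z)   _  = here y≡z
  ∈-─⁺ (there x∈ys) (there y∈ys) y≢x = there (∈-─⁺ x∈ys y∈ys y≢x)

  unique-⊆⇒length-≤ : {xs ys : List A} → Unique xs → xs ⊆ ys → length xs ℕ.≤ length ys
  unique-⊆⇒length-≤ {[]}     _               _   = z≤n
  unique-⊆⇒length-≤ {x ∷ xs} {ys} (x∉xs ∷ xs!) sub =
    subst (suc (length xs) ℕ.≤_) (sym (length-removeAt′ ys _))
      (s≤s (unique-⊆⇒length-≤ xs! λ y∈xs →
        ∈-─⁺ x∈ys (sub (there y∈xs)) λ y≡x → All.lookup x∉xs y∈xs (sym y≡x)))
    where
    x∈ys : x ∈ ys
    x∈ys = sub (here refl)

module _ {a b} {A : Set a} {B : Set b} (φ : A → B) where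

  unique-map⁺ : {xs : List A} → (∀ {x y} → x ∈ xs → y ∈ xs → φ x ≡ φ y → x ≡ y)
              → Unique xs → Unique (map φ xs)
  unique-map⁺ {[]}     _   []            = []
  unique-map⁺ {x ∷ xs} inj (x∉xs ∷ xs!) =
    All.map⁺ (All.tabulate λ y∈xs φx≡φy → All.lookup x∉xs y∈xs (inj (here refl) (there y∈xs) φx≡φy))
    ∷ unique-map⁺ (λ x∈xs y∈xs → inj (there x∈xs) (there y∈xs)) xs!

  length-<-of-injection : {xs : List A} {ys : List B} {w : B} → Unique xs
    → (∀ {x} → x ∈ xs → φ x ∈ ys)
    → (∀ {x y} → x ∈ xs → y ∈ xs → φ x ≡ φ y → x ≡ y)
    → w ∈ ys → (∀ {x} → x ∈ xs → φ x ≢ w)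
    → length xs ℕ.< length ys
  length-<-of-injection {xs} {ys} {w} xs! φ∈ys inj w∈ys w∉φxs =
    subst (ℕ._≤ length ys) (cong suc (length-map φ xs))
      (unique-⊆⇒length-≤ (w∉ ∷ unique-map⁺ inj xs!) image⊆ys)
    where
    w∉ : All (w ≢_) (map φ xs)
    w∉ = All.tabulate λ z∈ w≡z →
      let (x , x∈xs , z≡φx) = ∈-map⁻ φ z∈ in w∉φxs x∈xs (trans (sym z≡φx) (sym w≡z))
    image⊆ys : (w ∷ map φ xs) ⊆ ys
    image⊆ys (here refl) = w∈ys
    image⊆ys (there z∈) =
      let (x , x∈xs , z≡φx) = ∈-map⁻ φ z∈ in subst (_∈ ys) (sym z≡φx) (φ∈ys x∈xs)

InWindow : ℕ → ℤ → Set
InWindow n a = (+ 1 ≤ a) × (a ≤ + n)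

window : ∀ n .{{_ : ℕ.NonZero n}} z → ∃ λ t → InWindow n (z + t * + n)
window n z = - q , subst (InWindow n) (sym z-qn≡1+r) (+≤+ (s≤s z≤n) , +≤+ (n%ℕd<d (z - + 1) n))
  where
  q : ℤ
  q = (z - + 1) /ℕ n
  r : ℕ
  r = (z - + 1) %ℕ n
  z-qn≡1+r : z + - q * + n ≡ + 1 + + r
  z-qn≡1+r = begin
    z + - q * + n                   ≡⟨ regroup z q (+ n) ⟩
    + 1 + ((z - + 1) - q * + n)     ≡⟨ cong (λ y → + 1 + (y - q * + n)) (a≡a%ℕn+[a/ℕn]*n (z - + 1) n) ⟩
    + 1 + ((+ r + q * + n) - q * + n) ≡⟨ cancel (+ r) q (+ n) ⟩
    + 1 + + r                       ∎
    where
    open ≡-Reasoning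
    regroup : ∀ z q N → z + - q * N ≡ + 1 + ((z - + 1) - q * N)
    regroup = solve-∀
    cancel : ∀ r q N → + 1 + ((r + q * N) - q * N) ≡ + 1 + r
    cancel = solve-∀

window-< : ∀ {n a b s t} → InWindow n a → InWindow n b → s < t → a + s * + n < b + t * + n
window-< {n} {a} {b} {s} {t} (_ , a≤n) (1≤b , _) s<t = begin-strict
  a + s * + n         ≤⟨ ℤP.+-monoˡ-≤ (s * + n) a≤n ⟩
  + n + s * + n       ≡⟨ factor s (+ n) ⟩
  (ℤ.suc s) * + n     ≤⟨ ℤP.*-monoʳ-≤-nonNeg (+ n) (ℤP.i<j⇒suc[i]≤j s<t) ⟩
  t * + n             ≡⟨ ℤP.+-identityˡ (t * + n) ⟨
  + 0 + t * + n       <⟨ ℤP.+-monoˡ-< (t * + n) (ℤP.suc[i]≤j⇒i<j {i = + 0} 1≤b) ⟩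
  b + t * + n         ∎
  where
  open ℤP.≤-Reasoning
  factor : ∀ s N → N + s * N ≡ (+ 1 + s) * N
  factor = solve-∀

window-unique : ∀ {n a b s t} → InWindow n a → InWindow n b → a + s * + n ≡ b + t * + n → s ≡ t
window-unique {s = s} {t} a∈ b∈ eq with ℤP.<-cmp s t
... | tri< s<t _ _ = ⊥-elim (ℤP.<⇒≢ (window-< a∈ b∈ s<t) eq)
... | tri≈ _ s≡t _ = s≡t
... | tri> _ _ t<s = ⊥-elim (ℤP.<⇒≢ (window-< b∈ a∈ t<s) (sym eq))

Periodic : ℕ → (ℤ → ℤ) → Set
Periodic n g = ∀ a → g (a + + n) ≡ g a + + n

module _ {n : ℕ} (g : ℤ → ℤ) (g-periodic : Periodic n g) where

  private
    N : ℤ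
    N = + n

  periodic-+ℕ* : ∀ m x → g (x + + m * N) ≡ g x + + m * N
  periodic-+ℕ* zero    x = trans (cong g (ℤP.+-identityʳ x)) (sym (ℤP.+-identityʳ (g x)))
  periodic-+ℕ* (suc m) x = begin
    g (x + + suc m * N)  ≡⟨ cong g (unfold x (+ m) N) ⟩
    g (x + + m * N + N)  ≡⟨ g-periodic _ ⟩
    g (x + + m * N) + N  ≡⟨ cong (_+ N) (periodic-+ℕ* m x) ⟩
    g x + + m * N + N    ≡⟨ unfold (g x) (+ m) N ⟨
    g x + + suc m * N    ∎
    where
    open ≡-Reasoning
    unfold : ∀ y m N → y + (+ 1 + m) * N ≡ y + m * N + N
    unfold = solve-∀

  periodic-+* : ∀ d x → g (x + d * N) ≡ g x + d * N
  periodic-+* (+ m)    x = periodic-+ℕ* m x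
  periodic-+* -[1+ m ] x = ∙-cancelʳ (+ suc m * N) _ _ (begin
    g y + + suc m * N     ≡⟨ periodic-+ℕ* (suc m) y ⟨
    g (y + + suc m * N)   ≡⟨ cong g (undo x (+ suc m) N) ⟩
    g x                   ≡⟨ undo (g x) (+ suc m) N ⟨
    g x + -[1+ m ] * N + + suc m * N ∎)
    where
    open ≡-Reasoning
    y : ℤ
    y = x + -[1+ m ] * N
    undo : ∀ z m N → z + (- m) * N + m * N ≡ z
    undo = solve-∀

periodic-∘ : ∀ {n} (g h : ℤ → ℤ) → Periodic n g → Periodic n h → Periodic n (g ∘ h)
periodic-∘ g h g-periodic h-periodic a = trans (cong g (h-periodic a)) (g-periodic _)

periodic-from : ∀ {n} (h : Bij) → Periodic n (Inverse.to h) → Periodic n (Inverse.from h)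
periodic-from {n} h to-periodic a = begin
  from (a + + n)              ≡⟨ cong (λ b → from (b + + n)) (strictlyInverseˡ a) ⟨
  from (to (from a) + + n)    ≡⟨ cong from (to-periodic (from a)) ⟨
  from (to (from a + + n))    ≡⟨ strictlyInverseʳ _ ⟩
  from a + + n                ∎
  where open ≡-Reasoning
        open Inverse h

app-injective : (g : Bij) → ∀ {x y} → app g x ≡ app g y → x ≡ y
app-injective g = Injection.injective (Inverse⇒Injection g)

shift-inversion : ∀ {n} (g : Bij) → Periodic n (app g) → ∀ {p q t}
  → InWindow n (p + t * + n) → p < q → app g q < app g p
  → Inversion n g (p + t * + n , q + t * + n)
shift-inversion g g-periodic {p} {q} {t} (1≤p+tn , p+tn≤n) p<q gq<gp =
  1≤p+tn , p+tn≤n , ℤP.+-monoˡ-< (t * + _) p<q ,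
  subst₂ _<_ (sym (periodic-+* (app g) g-periodic t q)) (sym (periodic-+* (app g) g-periodic t p))
    (ℤP.+-monoˡ-< (t * + _) gq<gp)

module _ {n : ℕ} .{{_ : ℕ.NonZero n}} (f i : Bij)
         (f-periodic : Periodic n (app f)) (i-periodic : Periodic n (app i)) where

  private
    N : ℤ
    N = + n
    F I V : ℤ → ℤ
    F = app f
    I = app i
    V = app ((i ⁻¹ᵇ) ∘ᵇ f)

    v-periodic : Periodic n V
    v-periodic = periodic-∘ (Inverse.from i) F (periodic-from i i-periodic) f-periodic

    windowShift : ℤ → ℤ
    windowShift z = proj₁ (window n z)

  splitInversion : ℤ × ℤ → (ℤ × ℤ) ⊎ (ℤ × ℤ)
  splitInversion (p , q) with V q ℤP.<? V p
  ... | yes _ = inj₂ (p , q)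
  ... | no  _ = inj₁ (V p + windowShift (V p) * N , V q + windowShift (V p) * N)

  splitInversion-inversion : ∀ {x} → Inversion n f x
    → [ Inversion n i , Inversion n ((i ⁻¹ᵇ) ∘ᵇ f) ]′ (splitInversion x)
  splitInversion-inversion {p , q} (1≤p , p≤n , p<q , fq<fp) with V q ℤP.<? V p
  ... | yes vq<vp = 1≤p , p≤n , p<q , vq<vp
  ... | no  vq≮vp = shift-inversion i i-periodic {t = windowShift (V p)} (proj₂ (window n (V p))) vp<vq
                      (subst₂ _<_ (sym (IV q)) (sym (IV p)) fq<fp)
    where
    IV : ∀ x → I (V x) ≡ F x
    IV x = Inverse.strictlyInverseˡ i (F x)
    vp<vq : V p < V q
    vp<vq = ℤP.≤∧≢⇒< (ℤP.≮⇒≥ vq≮vp)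
              (λ vp≡vq → ℤP.<⇒≢ p<q (app-injective ((i ⁻¹ᵇ) ∘ᵇ f) vp≡vq))

  splitInversion-injective : ∀ {x y} → Inversion n f x → Inversion n f y
    → splitInversion x ≡ splitInversion y → x ≡ y
  splitInversion-injective {p , q} {p′ , q′} (1≤p , p≤n , _) (1≤p′ , p′≤n , _) eq
    with V q ℤP.<? V p | V q′ ℤP.<? V p′
  ... | yes _ | yes _ = inj₂-injective eq
  ... | no  _ | no  _ = cong₂ _,_ p≡p′ q≡q′
    where
    t t′ : ℤ
    t  = windowShift (V p)
    t′ = windowShift (V p′)
    p+tn≡p′+t′n : p + t * N ≡ p′ + t′ * N
    p+tn≡p′+t′n = app-injective ((i ⁻¹ᵇ) ∘ᵇ f) (begin
      V (p + t * N)    ≡⟨ periodic-+* V v-periodic t p ⟩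
      V p + t * N      ≡⟨ cong proj₁ (inj₁-injective eq) ⟩
      V p′ + t′ * N    ≡⟨ periodic-+* V v-periodic t′ p′ ⟨
      V (p′ + t′ * N)  ∎)
      where open ≡-Reasoning
    t≡t′ : t ≡ t′
    t≡t′ = window-unique (1≤p , p≤n) (1≤p′ , p′≤n) p+tn≡p′+t′n
    p≡p′ : p ≡ p′
    p≡p′ = ∙-cancelʳ (t * N) p p′ (trans p+tn≡p′+t′n (cong (λ s → p′ + s * N) (sym t≡t′)))
    q≡q′ : q ≡ q′
    q≡q′ = app-injective ((i ⁻¹ᵇ) ∘ᵇ f) (∙-cancelʳ (t * N) (V q) (V q′)
      (trans (cong proj₂ (inj₁-injective eq)) (cong (λ s → V q′ + s * N) (sym t≡t′))))

  ≤R⇒quotient-inversion-not-lost : i ≤R[ n ] f → ∀ {w} → Inversion n ((i ⁻¹ᵇ) ∘ᵇ f) w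
    → ¬ (F (proj₁ w) < F (proj₂ w))
  ≤R⇒quotient-inversion-not-lost
    (a , b , c , (Lf , Lf! , Lf⇔ , ∣Lf∣≡a) , (Li , _ , Li⇔ , ∣Li∣≡b) , (Lv , _ , Lv⇔ , ∣Lv∣≡c)
     , a≡b+c)
    {w} w-inv fw₁<fw₂ =
    ℕP.<-irrefl ∣Lf∣≡∣B∣
      (length-<-of-injection splitInversion Lf!
        (λ x∈ → ∈B (splitInversion-inversion (inv x∈)))
        (λ x∈ y∈ → splitInversion-injective (inv x∈) (inv y∈))
        (∈B {inj₂ w} w-inv)
        (λ x∈ → misses-w (inv x∈)))
    where
    inv : ∀ {x} → x ∈ Lf → Inversion n f x
    inv = Equivalence.to (Lf⇔ _)
    B : List ((ℤ × ℤ) ⊎ (ℤ × ℤ))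
    B = map inj₁ Li ++ map inj₂ Lv
    ∈B : ∀ {z} → [ Inversion n i , Inversion n ((i ⁻¹ᵇ) ∘ᵇ f) ]′ z → z ∈ B
    ∈B {inj₁ y} y-inv = ∈-++⁺ˡ (∈-map⁺ inj₁ (Equivalence.from (Li⇔ y) y-inv))
    ∈B {inj₂ y} y-inv = ∈-++⁺ʳ (map inj₁ Li) (∈-map⁺ inj₂ (Equivalence.from (Lv⇔ y) y-inv))
    misses-w : ∀ {x} → Inversion n f x → splitInversion x ≢ inj₂ w
    misses-w {p , q} (_ , _ , _ , fq<fp) with V q ℤP.<? V p
    ... | yes _ = λ x≡w → ℤP.<-asym fq<fp
                    (subst (λ x → F (proj₁ x) < F (proj₂ x)) (sym (inj₂-injective x≡w)) fw₁<fw₂)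
    ... | no  _ = λ ()
    ∣Lf∣≡∣B∣ : length Lf ≡ length B
    ∣Lf∣≡∣B∣ = begin
      length Lf                                   ≡⟨ trans ∣Lf∣≡a a≡b+c ⟩
      b ℕ.+ c                                     ≡⟨ cong₂ ℕ._+_ ∣Li∣≡b ∣Lv∣≡c ⟨
      length Li ℕ.+ length Lv                     ≡⟨ cong₂ ℕ._+_ (length-map inj₁ Li) (length-map inj₂ Lv) ⟨
      length (map inj₁ Li) ℕ.+ length (map inj₂ Lv) ≡⟨ length-++ (map inj₁ Li) ⟨
      length B                                    ∎
      where open ≡-Reasoning

  ≤R⇒quotient-inversion-is-inversion : i ≤R[ n ] f → ∀ {p q} → p < q → V q < V p → F q < F p
  ≤R⇒quotient-inversion-is-inversion i≤f {p} {q} p<q vq<vp with ℤP.<-cmp (F q) (F p)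
  ... | tri< fq<fp _ _ = fq<fp
  ... | tri≈ _ fq≡fp _ = ⊥-elim (ℤP.<⇒≢ p<q (sym (app-injective f fq≡fp)))
  ... | tri> _ _ fp<fq = ⊥-elim (≤R⇒quotient-inversion-not-lost i≤f
          (shift-inversion ((i ⁻¹ᵇ) ∘ᵇ f) v-periodic {t = t} p+tn∈ p<q vq<vp)
          (subst₂ _<_ (sym (periodic-+* F f-periodic t p)) (sym (periodic-+* F f-periodic t q))
            (ℤP.+-monoˡ-< (t * N) fp<fq)))
    where
    t : ℤ
    t = windowShift p
    p+tn∈ : InWindow n (p + t * N)
    p+tn∈ = proj₂ (window n p)

module _ {n : ℕ} (f i : Bij)
         (f-bounded : ∀ a → (a < app f a) × (app f a ≤ a + + n))
         (i⁻¹-periodic : Periodic n (Inverse.from i))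
         (quotient-inversion-is-inversion : ∀ {p q} → p < q
            → app ((i ⁻¹ᵇ) ∘ᵇ f) q < app ((i ⁻¹ᵇ) ∘ᵇ f) p → app f q < app f p)
         where

  private
    N : ℤ
    N = + n
    F I I⁻¹ F⁻¹ V M : ℤ → ℤ
    F = app f
    F⁻¹ = Inverse.from f
    I = app i
    I⁻¹ = Inverse.from i
    V = app ((i ⁻¹ᵇ) ∘ᵇ f)
    M = app ((i ⁻¹ᵇ) ∘ᵇ (f ∘ᵇ i))

  <-conjugate : ∀ x → x < M x
  <-conjugate x = ℤP.≤∧≢⇒< (ℤP.≮⇒≥ Mx≮x) x≢Mx
    where
    b : ℤ
    b = I x
    x≢Mx : x ≢ M x
    x≢Mx x≡Mx = ℤP.<⇒≢ (proj₁ (f-bounded b))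
      (sym (trans (sym (Inverse.strictlyInverseˡ i (F b))) (cong I (sym x≡Mx))))
    F⁻¹b<b : F⁻¹ b < b
    F⁻¹b<b = subst (F⁻¹ b <_) (Inverse.strictlyInverseˡ f b) (proj₁ (f-bounded (F⁻¹ b)))
    V[F⁻¹b]≡x : V (F⁻¹ b) ≡ x
    V[F⁻¹b]≡x = trans (cong I⁻¹ (Inverse.strictlyInverseˡ f b)) (Inverse.strictlyInverseʳ i x)
    Mx≮x : ¬ (M x < x)
    Mx≮x Mx<x = ℤP.<-asym (proj₁ (f-bounded b))
      (subst (F b <_) (Inverse.strictlyInverseˡ f b)
        (quotient-inversion-is-inversion F⁻¹b<b (subst (M x <_) (sym V[F⁻¹b]≡x) Mx<x)))

  conjugate-≤ : ∀ x → M x ≤ x + N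
  conjugate-≤ x = ℤP.≮⇒≥ λ x+N<Mx →
    let Vc<Vb : V c < V b
        Vc<Vb = subst (_< M x) (sym Vc≡x+N) x+N<Mx
    in ℤP.<⇒≱ (subst (_< F b) Fc≡b+N (quotient-inversion-is-inversion (b<c Vc<Vb) Vc<Vb))
              (proj₂ (f-bounded b))
    where
    b c : ℤ
    b = I x
    c = F⁻¹ (b + N)
    Fc≡b+N : F c ≡ b + N
    Fc≡b+N = Inverse.strictlyInverseˡ f (b + N)
    Vc≡x+N : V c ≡ x + N
    Vc≡x+N = trans (cong I⁻¹ Fc≡b+N) (trans (i⁻¹-periodic b) (cong (_+ N) (Inverse.strictlyInverseʳ i x)))
    b≤c : b ≤ c
    b≤c = ℤP.≮⇒≥ λ c<b →
      ℤP.<⇒≱ (subst (c + N <_) (sym Fc≡b+N) (ℤP.+-monoˡ-< N c<b)) (proj₂ (f-bounded c))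
    b<c : V c < V b → b < c
    b<c Vc<Vb = ℤP.≤∧≢⇒< b≤c (λ b≡c → ℤP.<⇒≢ Vc<Vb (cong V (sym b≡c)))

  conjugate-bounded : ∀ x → (x < M x) × (M x ≤ x + N)
  conjugate-bounded x = <-conjugate x , conjugate-≤ x

position : ∀ {n} → Fin n → ℤ
position j = + suc (toℕ j)

ReducesTo-∘ : ∀ {n} (g h : Bij) {σ τ : Permutation′ n} → Periodic n (app g)
  → ReducesTo n g σ → ReducesTo n h τ → ReducesTo n (g ∘ᵇ h) (σ ∘ₚ τ)
ReducesTo-∘ {n} g h {σ} {τ} g-periodic g↓σ h↓τ j with h↓τ j | g↓σ (τ ⟨$⟩ʳ j)
... | qh , h[j]≡ | qg , g[τj]≡ = qg + qh , (begin
  app g (app h (position j))                     ≡⟨ cong (app g) h[j]≡ ⟩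
  app g (position (τ ⟨$⟩ʳ j) + qh * + n)         ≡⟨ periodic-+* (app g) g-periodic qh _ ⟩
  app g (position (τ ⟨$⟩ʳ j)) + qh * + n         ≡⟨ cong (_+ qh * + n) g[τj]≡ ⟩
  position (σ ⟨$⟩ʳ (τ ⟨$⟩ʳ j)) + qg * + n + qh * + n
    ≡⟨ regroup (position (σ ⟨$⟩ʳ (τ ⟨$⟩ʳ j))) qg qh (+ n) ⟩
  position (σ ⟨$⟩ʳ (τ ⟨$⟩ʳ j)) + (qg + qh) * + n ∎)
  where
  open ≡-Reasoning
  regroup : ∀ x a b N → x + a * N + b * N ≡ x + (a + b) * N
  regroup = solve-∀

ReducesTo-⁻¹ : ∀ {n} (h : Bij) {σ : Permutation′ n} → Periodic n (app h)
  → ReducesTo n h σ → ReducesTo n (h ⁻¹ᵇ) (σ ⁻¹ₚ)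
ReducesTo-⁻¹ {n} h {σ} h-periodic h↓σ j with h↓σ (σ ⟨$⟩ˡ j)
... | q , h[σ⁻¹j]≡ = - q , (begin
  from (position j)                         ≡⟨ cong from (undo (position j) q (+ n)) ⟩
  from (position j + q * + n + (- q) * + n) ≡⟨ periodic-+* from (periodic-from h h-periodic) (- q) _ ⟩
  from (position j + q * + n) + (- q) * + n ≡⟨ cong (λ y → from y + (- q) * + n) h[σ⁻¹j]≡′ ⟨
  from (to (position (σ ⟨$⟩ˡ j))) + (- q) * + n ≡⟨ cong (_+ (- q) * + n) (strictlyInverseʳ _) ⟩
  position (σ ⟨$⟩ˡ j) + (- q) * + n         ∎)
  where
  open ≡-Reasoning
  open Inverse h
  h[σ⁻¹j]≡′ : to (position (σ ⟨$⟩ˡ j)) ≡ position j + q * + n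
  h[σ⁻¹j]≡′ = trans h[σ⁻¹j]≡ (cong (λ l → position l + q * + n) (Perm.inverseʳ σ))
  undo : ∀ x q N → x ≡ x + q * N + (- q) * N
  undo = solve-∀

displacement : (n : ℕ) → (ℤ → ℤ) → ℤ
displacement n g = ∑[ j < n ] (g (position j) - position j)

sumℤ-applyUpTo : ∀ n (h : ℕ → ℤ) → sumℤ (applyUpTo h n) ≡ ∑[ j < n ] h (toℕ j)
sumℤ-applyUpTo zero    h = refl
sumℤ-applyUpTo (suc n) h = cong (λ s → h 0 + s) (sumℤ-applyUpTo n (h ∘ suc))

sumℤ-displacements : ∀ n (g : ℤ → ℤ)
  → sumℤ (map (λ j → g (+ suc j) - + suc j) (upTo n)) ≡ displacement n g
sumℤ-displacements n g = trans (cong sumℤ (map-upTo _ n)) (sumℤ-applyUpTo n _)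

displacement-∘ : ∀ {n} (g : ℤ → ℤ) (h : Bij) {σ : Permutation′ n} → Periodic n g → ReducesTo n h σ
  → displacement n (g ∘ app h) ≡ displacement n g + displacement n (app h)
displacement-∘ {n} g h {σ} g-periodic h↓σ = begin
  ∑[ j < n ] (g (H (position j)) - position j)
    ≡⟨ sum-cong-≗ (λ (j : Fin n) → split (g (H (position j))) (H (position j)) (position j)) ⟩
  ∑[ j < n ] ((g (H (position j)) - H (position j)) + (H (position j) - position j))
    ≡⟨ ∑-distrib-+ (λ (j : Fin n) → g (H (position j)) - H (position j)) (λ j → H (position j) - position j) ⟩
  ∑[ j < n ] (g (H (position j)) - H (position j)) + displacement n H
    ≡⟨ cong (_+ displacement n H) (sum-cong-≗ reduce) ⟩
  ∑[ j < n ] (g (position (σ ⟨$⟩ʳ j)) - position (σ ⟨$⟩ʳ j)) + displacement n H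
    ≡⟨ cong (_+ displacement n H) (sum-permute (λ j → g (position j) - position j) σ) ⟨
  displacement n g + displacement n H ∎
  where
  open ≡-Reasoning
  H : ℤ → ℤ
  H = app h
  split : ∀ a b c → a - c ≡ (a - b) + (b - c)
  split = solve-∀
  cancel-shift : ∀ a x d N → (a + d * N) - (x + d * N) ≡ a - x
  cancel-shift = solve-∀
  reduce : ∀ (j : Fin n)
    → g (H (position j)) - H (position j) ≡ g (position (σ ⟨$⟩ʳ j)) - position (σ ⟨$⟩ʳ j)
  reduce j with h↓σ j
  ... | q , h[j]≡ = begin
    g (H (position j)) - H (position j)  ≡⟨ cong (λ y → g y - y) h[j]≡ ⟩
    g (x + q * + n) - (x + q * + n)      ≡⟨ cong (_- (x + q * + n)) (periodic-+* g g-periodic q x) ⟩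
    (g x + q * + n) - (x + q * + n)      ≡⟨ cancel-shift (g x) x q (+ n) ⟩
    g x - x                              ∎
    where
    x : ℤ
    x = position (σ ⟨$⟩ʳ j)

displacement-conjugate : ∀ {n} (f i : Bij) {ι μ : Permutation′ n}
  → Periodic n (app f) → Periodic n (app i)
  → ReducesTo n i ι → ReducesTo n ((i ⁻¹ᵇ) ∘ᵇ (f ∘ᵇ i)) μ
  → displacement n (app ((i ⁻¹ᵇ) ∘ᵇ (f ∘ᵇ i))) ≡ displacement n (app f)
displacement-conjugate {n} f i {ι} {μ} f-periodic i-periodic i↓ι m↓μ =
  ∙-cancelˡ (displacement n I) _ _ (begin
    displacement n I + displacement n M
      ≡⟨ displacement-∘ I ((i ⁻¹ᵇ) ∘ᵇ (f ∘ᵇ i)) {μ} i-periodic m↓μ ⟨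
    displacement n (I ∘ M)
      ≡⟨ sum-cong-≗ (λ (j : Fin n) → cong (_- position j) (I∘M≗F∘I (position j))) ⟩
    displacement n (F ∘ I)               ≡⟨ displacement-∘ F i {ι} f-periodic i↓ι ⟩
    displacement n F + displacement n I  ≡⟨ ℤP.+-comm (displacement n F) (displacement n I) ⟩
    displacement n I + displacement n F  ∎)
  where
  open ≡-Reasoning
  F I M : ℤ → ℤ
  F = app f
  I = app i
  M = app ((i ⁻¹ᵇ) ∘ᵇ (f ∘ᵇ i))
  I∘M≗F∘I : ∀ x → I (M x) ≡ F (I x)
  I∘M≗F∘I x = Inverse.strictlyInverseˡ i (F (I x))

Bound-0-empty : ∀ k (f : Bij) → ¬ Bound k 0 f
Bound-0-empty k f (_ , f-bounded , _) = ℤP.<⇒≱ (proj₁ (f-bounded (+ 0))) (proj₂ (f-bounded (+ 0)))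

lemma4p17 : (k n : ℕ) (π ι : Permutation′ n) (f i : Bij)
    → HasType k n π → HasType k n ι
    → IsLift k n π f → IsLift k n ι i
    → i ≤R[ n ] f
    → IsLift k n ((ι ⁻¹ₚ) ∘ₚ (π ∘ₚ ι)) ((i ⁻¹ᵇ) ∘ᵇ (f ∘ᵇ i))
lemma4p17 k zero π ι f i _ _ (f-bound , _) _ _ = ⊥-elim (Bound-0-empty k f f-bound)
lemma4p17 k n@(suc _) π ι f i _ _ ((f-periodic , f-bounded , f-sum) , f↓π) ((i-periodic , _) , i↓ι) i≤f =
  (m-periodic , m-bounded , m-sum) , m↓μ
  where
  m : Bij
  m = (i ⁻¹ᵇ) ∘ᵇ (f ∘ᵇ i)
  i⁻¹-periodic : Periodic n (Inverse.from i)
  i⁻¹-periodic = periodic-from i i-periodic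
  m-periodic : Periodic n (app m)
  m-periodic = periodic-∘ (Inverse.from i) (app f ∘ app i) i⁻¹-periodic
                 (periodic-∘ (app f) (app i) f-periodic i-periodic)
  m-bounded : ∀ a → (a < app m a) × (app m a ≤ a + + n)
  m-bounded = conjugate-bounded f i f-bounded i⁻¹-periodic
                (≤R⇒quotient-inversion-is-inversion f i f-periodic i-periodic i≤f)
  m↓μ : ReducesTo n m ((ι ⁻¹ₚ) ∘ₚ (π ∘ₚ ι))
  m↓μ = ReducesTo-∘ (i ⁻¹ᵇ) (f ∘ᵇ i) {ι ⁻¹ₚ} {π ∘ₚ ι} i⁻¹-periodic
          (ReducesTo-⁻¹ i {ι} i-periodic i↓ι) (ReducesTo-∘ f i {π} {ι} f-periodic f↓π i↓ι)
  m-sum : sumℤ (map (λ j → app m (+ suc j) - + suc j) (upTo n)) ≡ + (k ℕ.* n)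
  m-sum = begin
    sumℤ (map (λ j → app m (+ suc j) - + suc j) (upTo n)) ≡⟨ sumℤ-displacements n (app m) ⟩
    displacement n (app m)
      ≡⟨ displacement-conjugate f i {ι} {(ι ⁻¹ₚ) ∘ₚ (π ∘ₚ ι)} f-periodic i-periodic i↓ι m↓μ ⟩
    displacement n (app f)                                ≡⟨ sumℤ-displacements n (app f) ⟨
    sumℤ (map (λ j → app f (+ suc j) - + suc j) (upTo n)) ≡⟨ f-sum ⟩
    + (k ℕ.* n)                                           ∎
    where open ≡-Reasoning
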